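{- Let $3\le a<b$ be integers. Then there exists a connected graph $G$ such that $rc^\ell(G)=a$ and $src^\ell(G)=b$.
   Context: An edge-coloured path is rainbow if all its edges have distinct colours; a geodesic is a shortest path between its endpoints. An (not necessarily proper) edge-colouring of a connected graph is rainbow connected (resp. strongly rainbow connected) if any two vertices are joined by a rainbow path (resp. rainbow geodesic). An $r$-edge-list assignment of $G$ assigns to each edge $e$ a set $L(e)\subset\mathbb N$ with $|L(e)|\ge r$; an $L$-edge-colouring is an edge-colouring $c$ with $c(e)\in L(e)$ for all $e$. $rc^\ell(G)$ (resp. $src^\ell(G)$) is the minimum integer $r$ such that for every $r$-edge-list assignment $L$ of $G$ there exists a rainbow connected (resp. strongly rainbow connected) $L$-edge-colouring of $G$. -}

module Defs where

open import Data.Nat using (ℕ; zero; suc; _≤_; _<_)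
open import Data.Bool using (Bool; true; false)
open import Data.Fin using (Fin)
open import Data.List using (List; []; _∷_; length)
open import Data.List.Relation.Unary.Unique.Propositional using (Unique)
open import Data.List.Membership.Propositional using (_∈_)
open import Data.Product using (Σ; _×_; ∃; ∃-syntax)
open import Relation.Binary.PropositionalEquality using (_≡_)

record Graph : Set where
  field
    n          : ℕ
    adj        : Fin n → Fin n → Bool
    adj-sym    : ∀ i j → adj i j ≡ adj j i
    adj-irrefl : ∀ i → adj i i ≡ false

IsMinimum : (ℕ → Set) → ℕ → Set
IsMinimum P m = P m × (∀ r → P r → m ≤ r)

module _ (G : Graph) where
  open Graph G

  Adj : Fin n → Fin n → Set
  Adj i j = adj i j ≡ true

  data Walk : Fin n → Fin n → Set where
    []   : ∀ {u} → Walk u u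
    step : ∀ {u w v} → Adj u w → Walk w v → Walk u v

  vertices : ∀ {u v} → Walk u v → List (Fin n)
  vertices ([] {u})       = u ∷ []
  vertices (step {u} _ p) = u ∷ vertices p

  len : ∀ {u v} → Walk u v → ℕ
  len []         = zero
  len (step _ p) = suc (len p)

  IsPath : ∀ {u v} → Walk u v → Set
  IsPath p = Unique (vertices p)

  IsGeodesic : ∀ {u v} → Walk u v → Set
  IsGeodesic {u} {v} p = IsPath p × (∀ (q : Walk u v) → IsPath q → len p ≤ len q)

  Connected : Set
  Connected = (1 ≤ n) × (∀ u v → Σ (Walk u v) IsPath)

  IsEdgeColouring : (Fin n → Fin n → ℕ) → Set
  IsEdgeColouring c = ∀ i j → Adj i j → c i j ≡ c j i

  colours : (Fin n → Fin n → ℕ) → ∀ {u v} → Walk u v → List ℕ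
  colours c []                 = []
  colours c (step {u} {w} _ p) = c u w ∷ colours c p

  Rainbow : (Fin n → Fin n → ℕ) → ∀ {u v} → Walk u v → Set
  Rainbow c p = Unique (colours c p)

  RainbowConnected : (Fin n → Fin n → ℕ) → Set
  RainbowConnected c = ∀ u v → ∃[ p ] (IsPath {u} {v} p × Rainbow c p)

  StronglyRainbowConnected : (Fin n → Fin n → ℕ) → Set
  StronglyRainbowConnected c = ∀ u v → ∃[ p ] (IsGeodesic {u} {v} p × Rainbow c p)

  record ListAssignment (r : ℕ) : Set where
    field
      L     : Fin n → Fin n → List ℕ
      L-sym : ∀ i j → Adj i j → L i j ≡ L j i
      L-uniq : ∀ i j → Adj i j → Unique (L i j)
      L-size : ∀ i j → Adj i j → r ≤ length (L i j)

  IsLColouring : ∀ {r} → ListAssignment r → (Fin n → Fin n → ℕ) → Set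
  IsLColouring A c = IsEdgeColouring c × (∀ i j → Adj i j → c i j ∈ ListAssignment.L A i j)

  ListRC : ℕ → Set
  ListRC r = ∀ (A : ListAssignment r) → ∃[ c ] (IsLColouring A c × RainbowConnected c)

  ListSRC : ℕ → Set
  ListSRC r = ∀ (A : ListAssignment r) → ∃[ c ] (IsLColouring A c × StronglyRainbowConnected c)

  rcℓ≡ : ℕ → Set
  rcℓ≡ a = IsMinimum ListRC a

  srcℓ≡ : ℕ → Set
  srcℓ≡ b = IsMinimum ListSRC b

-- The graph has a hub adjacent to every other vertex, a leaves pendant at the hub, and
-- q = b − a rungs tip–core whose cores form a clique.  Leaves and tips (the outer vertices) are
-- pairwise non-adjacent and their only common neighbour is the hub.
--
-- Lower bounds: if every list is {0, …, r − 1}, two leaves (for r < a) or two outer vertices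
-- (for r < a + q) get hub edges of the same colour.  A walk between two leaves uses both of their
-- hub edges, and the only geodesic between two outer vertices is the path through the hub.
--
-- Upper bounds: colour the non-hub edges by the heads of their lists and choose only the hub
-- colours σ.  For src the outer vertices get distinct hub colours and core m avoids all of them
-- except that of tip m, so non-adjacent vertices have distinct hub colours and the path through
-- the hub is a rainbow geodesic.  For rc, lists of size a ≥ 3 suffice to give the leaves distinct
-- hub colours and to make the two hub edges and the rung edge of every rung pairwise distinct in
-- colour.  If two non-adjacent vertices share a hub colour, one of them lies on a rung, and going
-- around that rainbow triangle replaces its hub edge.

module Submission where

open import Defs
open import Data.Bool using (Bool; true; false; not)
import Data.Bool.Properties as Bool
open import Data.Empty using (⊥-elim)
open import Data.Fin using (Fin; zero; suc; fromℕ<)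
import Data.Fin.Properties as Fin
open import Data.Fin.Properties using (injective⇒≤; fromℕ<-injective; +↔⊎; 1↔⊤)
open import Data.List using (List; []; _∷_; length; filter; head; upTo; tabulate)
open import Data.List.Membership.Propositional using (_∈_; _∉_)
open import Data.List.Membership.Propositional.Properties using (∈-filter⁺; ∈-upTo⁻; ∈-tabulate⁺)
open import Data.List.Properties using (filter-notAll; length-upTo; length-tabulate)
open import Data.List.Relation.Unary.All as All using ([]; _∷_)
open import Data.List.Relation.Unary.AllPairs using ([]; _∷_)
open import Data.List.Relation.Unary.Any as Any using (here; there)
open import Data.List.Relation.Unary.Unique.Propositional using (Unique)
open import Data.List.Relation.Unary.Unique.Propositional.Properties using (upTo⁺)
open import Data.Maybe using (fromMaybe)
open import Data.Nat as ℕ using (ℕ; _≤_; _<_; _+_; _∸_; s≤s; s≤s⁻¹; z≤n)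
open import Data.Nat.Properties
  using (<-≤-trans; m<m+n; m≤m+n; +-suc; ≤-reflexive; ≤-trans; <⇒≤; m+[n∸m]≡n)
open import Data.Product using (Σ; _×_; _,_; proj₁; proj₂; ∃-syntax)
open import Data.Sum using (_⊎_; inj₁; inj₂; [_,_]′)
open import Data.Sum.Function.Propositional using (_⊎-↔_)
open import Data.Unit using (⊤; tt)
import Data.Vec.Functional as Vector
open import Function using (_∘_; Injective; _↔_; Inverse; Injection; mk⇔)
open import Function.Properties.Inverse using (↔-refl; ↔-sym; ↔-trans; ↔⇒↣)
open import Relation.Nullary using (¬_; Dec; yes; no; ¬?; contradiction)
open import Relation.Nullary.Decidable using (does; dec-true; dec-false; does-⇔)
open import Relation.Binary.Definitions using (DecidableEquality)
open import Relation.Binary.PropositionalEquality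
  using (_≡_; _≢_; refl; sym; trans; cong; subst; subst₂)

module _ {A : Set} (_≟_ : DecidableEquality A) where
  open import Data.List.Membership.DecPropositional _≟_ using (_∈?_)

  without : A → List A → List A
  without x = filter (λ y → ¬? (y ≟ x))

  length-without : ∀ {x ys} → x ∈ ys → length (without x ys) < length ys
  length-without {x} {ys} x∈ys =
    filter-notAll (λ y → ¬? (y ≟ x)) ys (Any.map (λ x≡y y≢x → y≢x (sym x≡y)) x∈ys)

  ∈-without⁺ : ∀ {x y ys} → y ∈ ys → y ≢ x → y ∈ without x ys
  ∈-without⁺ {x} = ∈-filter⁺ (λ y → ¬? (y ≟ x))

  fresh : ∀ {xs} ys → Unique xs → length ys < length xs → ∃[ x ] (x ∈ xs × x ∉ ys)
  fresh {x ∷ xs} ys (x∉xs ∷ xs-unique) |ys|≤|xs| with x ∈? ys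
  ... | no x∉ys = x , here refl , x∉ys
  ... | yes x∈ys
    with y , y∈xs , y∉ys′ ← fresh (without x ys) xs-unique
                             (<-≤-trans (length-without x∈ys) (s≤s⁻¹ |ys|≤|xs|))
    = y , there y∈xs , λ y∈ys → y∉ys′ (∈-without⁺ y∈ys λ y≡x → All.lookup x∉xs y∈xs (sym y≡x))

  distinctRepresentatives : ∀ {m} avoid (Ls : Fin m → List A) → (∀ i → Unique (Ls i)) →
    (∀ i → length avoid + m ≤ length (Ls i)) →
    ∃[ f ] ((∀ i → f i ∈ Ls i) × Injective _≡_ _≡_ f × (∀ i → f i ∉ avoid))
  distinctRepresentatives {ℕ.zero} avoid Ls Ls-unique Ls-long = (λ ()) , (λ ()) , (λ { {()} }) , (λ ())
  distinctRepresentatives {ℕ.suc m} avoid Ls Ls-unique Ls-long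
    with x , x∈L₀ , x∉avoid ← fresh avoid (Ls-unique zero)
                                (<-≤-trans (m<m+n _ (s≤s z≤n)) (Ls-long zero))
    with f , f∈Ls , f-injective , f∉avoid′ ←
           distinctRepresentatives (x ∷ avoid) (Ls ∘ suc) (Ls-unique ∘ suc)
             (λ i → subst (_≤ length (Ls (suc i))) (+-suc (length avoid) m) (Ls-long (suc i)))
    = x Vector.∷ f
    , (λ { zero → x∈L₀ ; (suc i) → f∈Ls i })
    , (λ { {zero} {zero} _ → refl
         ; {zero} {suc j} x≡fj → ⊥-elim (f∉avoid′ j (here (sym x≡fj)))
         ; {suc i} {zero} fi≡x → ⊥-elim (f∉avoid′ i (here fi≡x))
         ; {suc i} {suc j} fi≡fj → cong suc (f-injective fi≡fj) })
    , (λ { zero → x∉avoid ; (suc i) → f∉avoid′ i ∘ there })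

module _ (G : Graph) where
  open Graph G
  open ListAssignment

  Colouring : Set
  Colouring = Fin n → Fin n → ℕ

  RainbowPath : Colouring → Fin n → Fin n → Set
  RainbowPath c u v = ∃[ p ] (IsPath G {u} {v} p × Rainbow G c p)

  RainbowGeodesic : Colouring → Fin n → Fin n → Set
  RainbowGeodesic c u v = ∃[ p ] (IsGeodesic G {u} {v} p × Rainbow G c p)

  Adj? : ∀ u v → Dec (Adj G u v)
  Adj? u v = adj u v Bool.≟ true

  Adj-sym : ∀ {u v} → Adj G u v → Adj G v u
  Adj-sym {u} {v} e = trans (adj-sym v u) e

  Adj⇒≢ : ∀ {u v} → Adj G u v → u ≢ v
  Adj⇒≢ {u} e refl = contradiction (trans (sym e) (adj-irrefl u)) λ ()

  rainbowGeodesic⇒rainbowPath : ∀ {c u v} → RainbowGeodesic c u v → RainbowPath c u v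
  rainbowGeodesic⇒rainbowPath (p , (isPath , _) , rainbow) = p , isPath , rainbow

  rainbowGeodesic-refl : ∀ {c} u → RainbowGeodesic c u u
  rainbowGeodesic-refl u = [] , ([] ∷ [] , λ _ _ → z≤n) , []

  rainbowGeodesic-edge : ∀ {c u v} → Adj G u v → RainbowGeodesic c u v
  rainbowGeodesic-edge {u = u} {v} e = step e [] , (((Adj⇒≢ e ∷ []) ∷ [] ∷ []) , shortest) , ([] ∷ [])
    where
    shortest : ∀ (p : Walk G u v) → IsPath G p → 1 ≤ len G p
    shortest []         _ = ⊥-elim (Adj⇒≢ e refl)
    shortest (step _ _) _ = s≤s z≤n

  rainbowGeodesic-twoEdges : ∀ {c u w v} → u ≢ v → ¬ Adj G u v → Adj G u w → Adj G w v →
    c u w ≢ c w v → RainbowGeodesic c u v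
  rainbowGeodesic-twoEdges {u = u} {v = v} u≢v ¬uv uw wv colours≢ =
    step uw (step wv []) ,
    (((Adj⇒≢ uw ∷ u≢v ∷ []) ∷ (Adj⇒≢ wv ∷ []) ∷ [] ∷ []) , shortest) ,
    ((colours≢ ∷ []) ∷ [] ∷ [])
    where
    shortest : ∀ (p : Walk G u v) → IsPath G p → 2 ≤ len G p
    shortest []                  _ = ⊥-elim (u≢v refl)
    shortest (step e [])         _ = ⊥-elim (¬uv e)
    shortest (step _ (step _ _)) _ = s≤s (s≤s z≤n)

  lastEdge : ∀ c {w v} (p : Walk G w v) → w ≢ v → ∃[ u ] (Adj G u v × c u v ∈ colours G c p)
  lastEdge c []                         w≢v = ⊥-elim (w≢v refl)
  lastEdge c {v = v} (step {w = w} e p) _ with w Fin.≟ v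
  ... | yes refl = _ , e , here refl
  ... | no w≢v with u , uv , c∈p ← lastEdge c p w≢v = u , uv , there c∈p

  PendantAt : Fin n → Fin n → Set
  PendantAt z u = ∀ {w} → Adj G u w → w ≡ z

  pendant-rainbowWalk⇒≡ : ∀ {c z u v} → IsEdgeColouring G c → PendantAt z u → PendantAt z v →
    c u z ≡ c v z → (p : Walk G u v) → Rainbow G c p → u ≡ v
  pendant-rainbowWalk⇒≡ ec pendant-u pendant-v same []       _ = refl
  pendant-rainbowWalk⇒≡ {c} {v = v} ec pendant-u pendant-v same (step {w = w} uw p) (cuw∉p ∷ _)
    with refl ← pendant-u uw | w Fin.≟ v
  ... | yes refl = pendant-v (Adj-sym uw)
  ... | no w≢v
    with x , xv , cxv∈p ← lastEdge c p w≢v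
    with refl ← pendant-v (Adj-sym xv) =
    ⊥-elim (All.lookup cuw∉p cxv∈p (trans same (ec v w (Adj-sym xv))))

  uniqueCommonNeighbour-¬rainbowGeodesic : ∀ {c z u v} → u ≢ v → ¬ Adj G u v → Adj G u z → Adj G z v →
    (∀ {w} → Adj G u w → Adj G w v → w ≡ z) → c u z ≡ c z v →
    (p : Walk G u v) → IsGeodesic G p → ¬ Rainbow G c p
  uniqueCommonNeighbour-¬rainbowGeodesic {c} {u = u} {v} u≢v ¬uv uz zv common same p (_ , shortest) =
    noShortRainbowWalk p (shortest viaZ viaZ-isPath)
    where
    viaZ : Walk G u v
    viaZ = step uz (step zv [])
    viaZ-isPath : IsPath G viaZ
    viaZ-isPath = (Adj⇒≢ uz ∷ u≢v ∷ []) ∷ (Adj⇒≢ zv ∷ []) ∷ [] ∷ []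
    noShortRainbowWalk : ∀ (q : Walk G u v) → len G q ≤ 2 → ¬ Rainbow G c q
    noShortRainbowWalk []                           _ _ = u≢v refl
    noShortRainbowWalk (step e [])                  _ _ = ¬uv e
    noShortRainbowWalk (step uw (step wv [])) _ ((cuw≢cwv ∷ []) ∷ _) with refl ← common uw wv = cuw≢cwv same
    noShortRainbowWalk (step _ (step _ (step _ _))) (s≤s (s≤s ())) _

  constantAssignment : ∀ r → ListAssignment G r
  constantAssignment r = record
    { L = λ _ _ → upTo r ; L-sym = λ _ _ _ → refl ; L-uniq = λ _ _ _ → upTo⁺ r
    ; L-size = λ _ _ _ → ≤-reflexive (sym (length-upTo r)) }

  listColouring-lowerBound : ∀ {m r} (P : Colouring → Set) {z} (s : Fin m → Fin n) →
    (∀ i → Adj G (s i) z) →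
    (∀ {c} → IsEdgeColouring G c → P c → ∀ {i j} → i ≢ j → c (s i) z ≢ c (s j) z) →
    (∀ (A : ListAssignment G r) → ∃[ c ] (IsLColouring G A c × P c)) → m ≤ r
  listColouring-lowerBound P {z} s adjacent separated listP
    with c , (ec , c∈L) , Pc ← listP (constantAssignment _) = injective⇒≤ injective
    where
    below : ∀ i → c (s i) z < _
    below i = ∈-upTo⁻ (c∈L (s i) z (adjacent i))
    injective : Injective _≡_ _≡_ (λ i → fromℕ< (below i))
    injective {i} {j} eq with i Fin.≟ j
    ... | yes i≡j = i≡j
    ... | no i≢j  = contradiction (fromℕ<-injective _ _ (below i) (below j) eq) (separated ec Pc i≢j)

  listRC⇒connected : ∀ {r} → 1 ≤ n → ListRC G r → Connected G
  listRC⇒connected {r} 1≤n listRC =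
    1≤n , λ u v → let p , isPath , _ = proj₂ (proj₂ (listRC (constantAssignment r))) u v in p , isPath

  headColouring : ∀ {r} → ListAssignment G r → Colouring
  headColouring A u v = fromMaybe 0 (head (L A u v))

  headColouring-isLColouring : ∀ {r} (A : ListAssignment G r) → 1 ≤ r → IsLColouring G A (headColouring A)
  headColouring-isLColouring A 1≤r =
    (λ u v e → cong (fromMaybe 0 ∘ head) (L-sym A u v e)) ,
    (λ u v e → head∈ (L A u v) (≤-trans 1≤r (L-size A u v e)))
    where
    head∈ : ∀ xs → 1 ≤ length xs → fromMaybe 0 (head xs) ∈ xs
    head∈ (x ∷ _) _ = here refl

  module HubColouring (z : Fin n) (σ : Fin n → ℕ) (d : Colouring) where

    hubColouring : Colouring
    hubColouring u v with u Fin.≟ z | v Fin.≟ z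
    ... | yes _ | _     = σ v
    ... | no _  | yes _ = σ u
    ... | no _  | no _  = d u v

    hubColouring-toHub : ∀ u → hubColouring u z ≡ σ u
    hubColouring-toHub u with u Fin.≟ z | z Fin.≟ z
    ... | yes refl | _       = refl
    ... | no _     | yes _   = refl
    ... | no _     | no z≢z = contradiction refl z≢z

    hubColouring-fromHub : ∀ v → hubColouring z v ≡ σ v
    hubColouring-fromHub v with z Fin.≟ z
    ... | yes _   = refl
    ... | no z≢z = contradiction refl z≢z

    hubColouring-offHub : ∀ {u v} → u ≢ z → v ≢ z → hubColouring u v ≡ d u v
    hubColouring-offHub {u} {v} u≢z v≢z with u Fin.≟ z | v Fin.≟ z
    ... | yes u≡z | _       = contradiction u≡z u≢z
    ... | no _    | yes v≡z = contradiction v≡z v≢z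
    ... | no _    | no _    = refl

    hubColouring-isLColouring : ∀ {r} (A : ListAssignment G r) → IsLColouring G A d →
      (∀ {v} → v ≢ z → σ v ∈ L A z v) → IsLColouring G A hubColouring
    hubColouring-isLColouring A (d-sym , d∈L) σ∈L = symmetric , inLists
      where
      symmetric : IsEdgeColouring G hubColouring
      symmetric u v e = by (u Fin.≟ z) (v Fin.≟ z)
        where
        by : Dec (u ≡ z) → Dec (v ≡ z) → hubColouring u v ≡ hubColouring v u
        by (yes refl) _          = trans (hubColouring-fromHub v) (sym (hubColouring-toHub v))
        by (no _)     (yes refl) = trans (hubColouring-toHub u) (sym (hubColouring-fromHub u))
        by (no u≢z)   (no v≢z)   = trans (hubColouring-offHub u≢z v≢z)
                                     (trans (d-sym u v e) (sym (hubColouring-offHub v≢z u≢z)))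
      inLists : ∀ u v → Adj G u v → hubColouring u v ∈ L A u v
      inLists u v e = by (u Fin.≟ z) (v Fin.≟ z)
        where
        by : Dec (u ≡ z) → Dec (v ≡ z) → hubColouring u v ∈ L A u v
        by (yes refl) _          = subst (_∈ L A z v) (sym (hubColouring-fromHub v)) (σ∈L (Adj⇒≢ e ∘ sym))
        by (no u≢z)   (yes refl) =
          subst₂ _∈_ (sym (hubColouring-toHub u)) (L-sym A z u (Adj-sym e)) (σ∈L u≢z)
        by (no u≢z)   (no v≢z)   = subst (_∈ L A u v) (sym (hubColouring-offHub u≢z v≢z)) (d∈L u v e)

    -- The triangle z v w is rainbow: its edges are coloured σ v, σ w and d w v.
    record RainbowTriangle (v : Fin n) : Set where
      field
        w      : Fin n
        w≢z    : w ≢ z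
        w≢v    : w ≢ v
        wv     : Adj G w v
        σv≢σw  : σ v ≢ σ w
        σv≢dwv : σ v ≢ d w v
        σw≢dwv : σ w ≢ d w v

    module _ (universal : ∀ {v} → v ≢ z → Adj G z v) where

      nonadjacent⇒≢hub : ∀ {u v} → u ≢ v → ¬ Adj G u v → u ≢ z
      nonadjacent⇒≢hub u≢v ¬uv refl = ¬uv (universal (u≢v ∘ sym))

      rainbowGeodesic-viaHub : ∀ {u v} → u ≢ v → ¬ Adj G u v → σ u ≢ σ v →
        RainbowGeodesic hubColouring u v
      rainbowGeodesic-viaHub {u} {v} u≢v ¬uv σu≢σv =
        rainbowGeodesic-twoEdges u≢v ¬uv (Adj-sym (universal u≢z)) (universal v≢z)
          (subst₂ _≢_ (sym (hubColouring-toHub u)) (sym (hubColouring-fromHub v)) σu≢σv)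
        where
        u≢z : u ≢ z
        u≢z = nonadjacent⇒≢hub u≢v ¬uv
        v≢z : v ≢ z
        v≢z = nonadjacent⇒≢hub (u≢v ∘ sym) (¬uv ∘ Adj-sym)

      stronglyRainbowConnected-viaHub : (∀ {u v} → u ≢ v → ¬ Adj G u v → σ u ≢ σ v) →
        StronglyRainbowConnected G hubColouring
      stronglyRainbowConnected-viaHub separated u v with u Fin.≟ v | Adj? u v
      ... | yes refl | _       = rainbowGeodesic-refl u
      ... | no _     | yes uv  = rainbowGeodesic-edge uv
      ... | no u≢v   | no ¬uv  = rainbowGeodesic-viaHub u≢v ¬uv (separated u≢v ¬uv)

      rainbowPath-triangleʳ : ∀ {u v} → u ≢ v → ¬ Adj G u v → σ u ≡ σ v → RainbowTriangle v →
        RainbowPath hubColouring u v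
      rainbowPath-triangleʳ {u} {v} u≢v ¬uv σu≡σv t =
        step (Adj-sym (universal u≢z)) (step (universal w≢z) (step wv [])) ,
        ((u≢z ∷ u≢w ∷ u≢v ∷ []) ∷ ((w≢z ∘ sym) ∷ (v≢z ∘ sym) ∷ []) ∷ (w≢v ∷ []) ∷ [] ∷ []) ,
        rainbow
        where
        open RainbowTriangle t
        u≢z : u ≢ z
        u≢z = nonadjacent⇒≢hub u≢v ¬uv
        v≢z : v ≢ z
        v≢z = nonadjacent⇒≢hub (u≢v ∘ sym) (¬uv ∘ Adj-sym)
        u≢w : u ≢ w
        u≢w refl = ¬uv wv
        rainbow : Unique (hubColouring u z ∷ hubColouring z w ∷ hubColouring w v ∷ [])
        rainbow rewrite hubColouring-toHub u | hubColouring-fromHub w | hubColouring-offHub w≢z v≢z | σu≡σv =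
          (σv≢σw ∷ σv≢dwv ∷ []) ∷ (σw≢dwv ∷ []) ∷ [] ∷ []

      rainbowPath-triangleˡ : IsEdgeColouring G d → ∀ {u v} → u ≢ v → ¬ Adj G u v → σ u ≡ σ v →
        RainbowTriangle u → RainbowPath hubColouring u v
      rainbowPath-triangleˡ d-sym {u} {v} u≢v ¬uv σu≡σv t =
        step (Adj-sym wu) (step (Adj-sym (universal w≢z)) (step (universal v≢z) [])) ,
        ((u≢w ∷ u≢z ∷ u≢v ∷ []) ∷ (w≢z ∷ w≢v′ ∷ []) ∷ ((v≢z ∘ sym) ∷ []) ∷ [] ∷ []) ,
        rainbow
        where
        open RainbowTriangle t renaming (w≢v to w≢u; wv to wu)
        u≢z : u ≢ z
        u≢z = nonadjacent⇒≢hub u≢v ¬uv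
        v≢z : v ≢ z
        v≢z = nonadjacent⇒≢hub (u≢v ∘ sym) (¬uv ∘ Adj-sym)
        u≢w : u ≢ w
        u≢w = w≢u ∘ sym
        w≢v′ : w ≢ v
        w≢v′ refl = ¬uv (Adj-sym wu)
        rainbow : Unique (hubColouring u w ∷ hubColouring w z ∷ hubColouring z v ∷ [])
        rainbow rewrite hubColouring-offHub u≢z w≢z | hubColouring-toHub w | hubColouring-fromHub v
                      | sym (d-sym w u wu) | sym σu≡σv =
          ((σw≢dwv ∘ sym) ∷ (σv≢dwv ∘ sym) ∷ []) ∷ ((σv≢σw ∘ sym) ∷ []) ∷ [] ∷ []

      rainbowConnected-viaHub : IsEdgeColouring G d →
        (∀ {u v} → u ≢ v → ¬ Adj G u v → σ u ≡ σ v → RainbowTriangle v ⊎ RainbowTriangle u) →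
        RainbowConnected G hubColouring
      rainbowConnected-viaHub d-sym triangle u v with u Fin.≟ v | Adj? u v | σ u ℕ.≟ σ v
      ... | yes refl | _      | _         = rainbowGeodesic⇒rainbowPath (rainbowGeodesic-refl u)
      ... | no _     | yes uv | _         = rainbowGeodesic⇒rainbowPath (rainbowGeodesic-edge uv)
      ... | no u≢v   | no ¬uv | no σu≢σv  =
        rainbowGeodesic⇒rainbowPath (rainbowGeodesic-viaHub u≢v ¬uv σu≢σv)
      ... | no u≢v   | no ¬uv | yes σu≡σv =
        [ rainbowPath-triangleʳ u≢v ¬uv σu≡σv , rainbowPath-triangleˡ d-sym u≢v ¬uv σu≡σv ]′
          (triangle u≢v ¬uv σu≡σv)

does-sym : ∀ {n} (i j : Fin n) → does (i Fin.≟ j) ≡ does (j Fin.≟ i)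
does-sym i j = does-⇔ (mk⇔ sym sym) (i Fin.≟ j) (j Fin.≟ i)

does⇒≡ : ∀ {n} {i j : Fin n} → does (i Fin.≟ j) ≡ true → i ≡ j
does⇒≡ {i = i} {j} = from-does (i Fin.≟ j)
  where
  from-does : (i≟j : Dec (i ≡ j)) → does i≟j ≡ true → i ≡ j
  from-does (yes i≡j) _ = i≡j

module Construction (a q : ℕ) where

  Outer : Set
  Outer = Fin a ⊎ Fin q

  Label : Set
  Label = ⊤ ⊎ (Outer ⊎ Fin q)

  pattern hub     = inj₁ tt
  pattern outer s = inj₂ (inj₁ s)
  pattern leaf i  = outer (inj₁ i)
  pattern tip m   = outer (inj₂ m)
  pattern core m  = inj₂ (inj₂ m)

  adjacent : Label → Label → Bool
  adjacent hub      hub       = false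
  adjacent hub      _         = true
  adjacent _        hub       = true
  adjacent (tip m)  (core m′) = does (m Fin.≟ m′)
  adjacent (core m) (tip m′)  = does (m Fin.≟ m′)
  adjacent (core m) (core m′) = not (does (m Fin.≟ m′))
  adjacent _        _         = false

  adjacent-sym : ∀ ℓ ℓ′ → adjacent ℓ ℓ′ ≡ adjacent ℓ′ ℓ
  adjacent-sym hub       hub       = refl
  adjacent-sym hub       (outer _) = refl
  adjacent-sym hub       (core _)  = refl
  adjacent-sym (outer _) hub       = refl
  adjacent-sym (core _)  hub       = refl
  adjacent-sym (leaf _)  (leaf _)  = refl
  adjacent-sym (leaf _)  (tip _)   = refl
  adjacent-sym (tip _)   (leaf _)  = refl
  adjacent-sym (tip _)   (tip _)   = refl
  adjacent-sym (leaf _)  (core _)  = refl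
  adjacent-sym (core _)  (leaf _)  = refl
  adjacent-sym (tip m)   (core m′) = does-sym m m′
  adjacent-sym (core m)  (tip m′)  = does-sym m m′
  adjacent-sym (core m)  (core m′) = cong not (does-sym m m′)

  adjacent-irrefl : ∀ ℓ → adjacent ℓ ℓ ≡ false
  adjacent-irrefl hub      = refl
  adjacent-irrefl (leaf _) = refl
  adjacent-irrefl (tip _)  = refl
  adjacent-irrefl (core m) = cong not (dec-true (m Fin.≟ m) refl)

  adjacent-fromHub : ∀ {ℓ} → ℓ ≢ hub → adjacent hub ℓ ≡ true
  adjacent-fromHub {hub}     ℓ≢hub = contradiction refl ℓ≢hub
  adjacent-fromHub {outer _} _     = refl
  adjacent-fromHub {core _}  _     = refl

  adjacent-toHub : ∀ {ℓ} → ℓ ≢ hub → adjacent ℓ hub ≡ true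
  adjacent-toHub {ℓ} ℓ≢hub = trans (adjacent-sym ℓ hub) (adjacent-fromHub ℓ≢hub)

  adjacent-rung : ∀ m → adjacent (tip m) (core m) ≡ true
  adjacent-rung m = dec-true (m Fin.≟ m) refl

  leaf-adjacent : ∀ i ℓ → adjacent (leaf i) ℓ ≡ true → ℓ ≡ hub
  leaf-adjacent i hub _ = refl

  outer-nonadjacent : ∀ s s′ → adjacent (outer s) (outer s′) ≡ false
  outer-nonadjacent (inj₁ _) (inj₁ _) = refl
  outer-nonadjacent (inj₁ _) (inj₂ _) = refl
  outer-nonadjacent (inj₂ _) (inj₁ _) = refl
  outer-nonadjacent (inj₂ _) (inj₂ _) = refl

  outer-commonNeighbour : ∀ {s s′} ℓ → s ≢ s′ →
    adjacent (outer s) ℓ ≡ true → adjacent ℓ (outer s′) ≡ true → ℓ ≡ hub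
  outer-commonNeighbour hub _ _ _ = refl
  outer-commonNeighbour {s} (outer s″) _ sℓ _ =
    contradiction (trans (sym sℓ) (outer-nonadjacent s s″)) λ ()
  outer-commonNeighbour {inj₂ m₁} {inj₂ m₂} (core m) s≢s′ sℓ ℓs′ =
    contradiction (cong inj₂ (trans (does⇒≡ sℓ) (does⇒≡ ℓs′))) s≢s′

  N : ℕ
  N = 1 + (a + q + q)

  -- Opaque, so that label and vertex do not unfold into splitAt/join terms that block unification.
  opaque
    labelling : Fin N ↔ Label
    labelling = ↔-trans +↔⊎ (1↔⊤ ⊎-↔ (↔-trans +↔⊎ (+↔⊎ ⊎-↔ ↔-refl)))

    label : Fin N → Label
    label = Inverse.to labelling

    vertex : Label → Fin N
    vertex = Inverse.from labelling

    label-vertex : ∀ ℓ → label (vertex ℓ) ≡ ℓ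
    label-vertex = Inverse.strictlyInverseˡ labelling

    vertex-label : ∀ u → vertex (label u) ≡ u
    vertex-label = Inverse.strictlyInverseʳ labelling

  vertex-injective : Injective _≡_ _≡_ vertex
  vertex-injective {ℓ} {ℓ′} eq = trans (sym (label-vertex ℓ)) (trans (cong label eq) (label-vertex ℓ′))

  label⇒vertex : ∀ {u ℓ} → label u ≡ ℓ → u ≡ vertex ℓ
  label⇒vertex {u} eq = trans (sym (vertex-label u)) (cong vertex eq)

  label≢ : ∀ {u v} → u ≢ v → label u ≢ label v
  label≢ {v = v} u≢v eq = u≢v (trans (label⇒vertex eq) (vertex-label v))

  G : Graph
  G = record
    { n          = N
    ; adj        = λ u v → adjacent (label u) (label v)
    ; adj-sym    = λ u v → adjacent-sym (label u) (label v)
    ; adj-irrefl = adjacent-irrefl ∘ label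
    }

  Adj-vertex : ∀ {ℓ ℓ′} → adjacent ℓ ℓ′ ≡ true → Adj G (vertex ℓ) (vertex ℓ′)
  Adj-vertex {ℓ} {ℓ′} = subst₂ (λ x y → adjacent x y ≡ true) (sym (label-vertex ℓ)) (sym (label-vertex ℓ′))

  Adj-vertex⁻ : ∀ {ℓ ℓ′} → Adj G (vertex ℓ) (vertex ℓ′) → adjacent ℓ ℓ′ ≡ true
  Adj-vertex⁻ {ℓ} {ℓ′} = subst₂ (λ x y → adjacent x y ≡ true) (label-vertex ℓ) (label-vertex ℓ′)

  ¬Adj-vertex : ∀ {ℓ ℓ′} → adjacent ℓ ℓ′ ≡ false → ¬ Adj G (vertex ℓ) (vertex ℓ′)
  ¬Adj-vertex {ℓ} {ℓ′} nonadjacent e = contradiction (trans (sym (Adj-vertex⁻ e)) nonadjacent) λ ()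

  Adj-vertexˡ : ∀ {ℓ w} → Adj G (vertex ℓ) w → adjacent ℓ (label w) ≡ true
  Adj-vertexˡ {ℓ} {w} = subst (λ x → adjacent x (label w) ≡ true) (label-vertex ℓ)

  Adj-vertexʳ : ∀ {w ℓ} → Adj G w (vertex ℓ) → adjacent (label w) ℓ ≡ true
  Adj-vertexʳ {w} {ℓ} = subst (λ x → adjacent (label w) x ≡ true) (label-vertex ℓ)

  z : Fin N
  z = vertex hub

  vertex≢z : ∀ {ℓ} → ℓ ≢ hub → vertex ℓ ≢ z
  vertex≢z ℓ≢hub = ℓ≢hub ∘ vertex-injective

  universal : ∀ {v} → v ≢ z → Adj G z v
  universal v≢z rewrite label-vertex hub = adjacent-fromHub (v≢z ∘ label⇒vertex)

  Adj-vertex-hub : ∀ ℓ → ℓ ≢ hub → Adj G (vertex ℓ) z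
  Adj-vertex-hub ℓ ℓ≢hub = Adj-sym G (universal (vertex≢z ℓ≢hub))

  leaf-pendant : ∀ i → PendantAt G z (vertex (leaf i))
  leaf-pendant i {w} e = label⇒vertex (leaf-adjacent i (label w) (Adj-vertexˡ e))

  outerVertex : Fin (a + q) → Fin N
  outerVertex = vertex ∘ outer ∘ Inverse.to +↔⊎

  outerVertex-injective : Injective _≡_ _≡_ outerVertex
  outerVertex-injective = Injection.injective (↔⇒↣ +↔⊎) ∘ outer-injective ∘ vertex-injective
    where
    outer-injective : ∀ {s s′} → outer s ≡ outer s′ → s ≡ s′
    outer-injective refl = refl

  listRC⇒a≤ : ∀ r → ListRC G r → a ≤ r
  listRC⇒a≤ r = listColouring-lowerBound G (RainbowConnected G) (vertex ∘ leaf)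
    (λ i → Adj-vertex-hub (leaf i) λ ()) separated
    where
    separated : ∀ {c} → IsEdgeColouring G c → RainbowConnected G c →
      ∀ {i j} → i ≢ j → c (vertex (leaf i)) z ≢ c (vertex (leaf j)) z
    separated ec rc {i} {j} i≢j same
      with p , _ , rainbow ← rc (vertex (leaf i)) (vertex (leaf j))
      with refl ← vertex-injective {leaf i} {leaf j}
                    (pendant-rainbowWalk⇒≡ G ec (leaf-pendant i) (leaf-pendant j) same p rainbow)
      = i≢j refl

  listSRC⇒a+q≤ : ∀ r → ListSRC G r → a + q ≤ r
  listSRC⇒a+q≤ r = listColouring-lowerBound G (StronglyRainbowConnected G) outerVertex
    (λ i → Adj-vertex-hub _ λ ()) separated
    where
    separated : ∀ {c} → IsEdgeColouring G c → StronglyRainbowConnected G c →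
      ∀ {i j} → i ≢ j → c (outerVertex i) z ≢ c (outerVertex j) z
    separated {c} ec src {i} {j} i≢j same
      with p , geodesic , rainbow ← src (outerVertex i) (outerVertex j) =
      uniqueCommonNeighbour-¬rainbowGeodesic G (i≢j ∘ outerVertex-injective) nonadjacent
        (Adj-vertex-hub _ λ ()) (universal (vertex≢z λ ())) common
        (trans same (ec _ z (Adj-vertex-hub _ λ ()))) p geodesic rainbow
      where
      s s′ : Outer
      s  = Inverse.to +↔⊎ i
      s′ = Inverse.to +↔⊎ j
      nonadjacent : ¬ Adj G (outerVertex i) (outerVertex j)
      nonadjacent = ¬Adj-vertex (outer-nonadjacent s s′)
      common : ∀ {w} → Adj G (outerVertex i) w → Adj G w (outerVertex j) → w ≡ z
      common {w} e e′ = label⇒vertex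
        (outer-commonNeighbour (label w) (i≢j ∘ Injection.injective (↔⇒↣ +↔⊎))
          (Adj-vertexˡ e) (Adj-vertexʳ e′))

  module HubLists {r} (A : ListAssignment G r) where
    open ListAssignment A

    hubList : Label → List ℕ
    hubList ℓ = L z (vertex ℓ)

    hubList-unique : ∀ {ℓ} → ℓ ≢ hub → Unique (hubList ℓ)
    hubList-unique ℓ≢hub = L-uniq z _ (universal (vertex≢z ℓ≢hub))

    hubList-size : ∀ {ℓ} → ℓ ≢ hub → r ≤ length (hubList ℓ)
    hubList-size ℓ≢hub = L-size z _ (universal (vertex≢z ℓ≢hub))

    d : Colouring G
    d = headColouring G A

    module Hub (σ : Label → ℕ) = HubColouring G z (σ ∘ label) d

    hubListColouring-isLColouring : 1 ≤ r → (σ : Label → ℕ) →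
      (∀ {ℓ} → ℓ ≢ hub → σ ℓ ∈ hubList ℓ) → IsLColouring G A (Hub.hubColouring σ)
    hubListColouring-isLColouring 1≤r σ σ∈hubList =
      Hub.hubColouring-isLColouring σ A (headColouring-isLColouring G A 1≤r)
        (λ {v} v≢z → subst (λ u → σ (label v) ∈ L z u) (vertex-label v) (σ∈hubList (v≢z ∘ label⇒vertex)))

  module RainbowColouring (3≤a : 3 ≤ a) (A : ListAssignment G a) where
    open HubLists A

    rungColour : Fin q → ℕ
    rungColour m = d (vertex (tip m)) (vertex (core m))

    leafColours : ∃[ f ] ((∀ i → f i ∈ hubList (leaf i)) × Injective _≡_ _≡_ f × (∀ i → f i ∉ []))
    leafColours = distinctRepresentatives ℕ._≟_ [] (hubList ∘ leaf)
                    (λ _ → hubList-unique λ ()) (λ _ → hubList-size λ ())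

    tipColour : ∀ m → ∃[ x ] (x ∈ hubList (tip m) × x ∉ rungColour m ∷ [])
    tipColour m = fresh ℕ._≟_ _ (hubList-unique λ ())
                    (≤-trans (s≤s (s≤s z≤n)) (≤-trans 3≤a (hubList-size λ ())))

    coreColour : ∀ m → ∃[ x ] (x ∈ hubList (core m) × x ∉ rungColour m ∷ proj₁ (tipColour m) ∷ [])
    coreColour m = fresh ℕ._≟_ _ (hubList-unique λ ()) (≤-trans 3≤a (hubList-size λ ()))

    σ : Label → ℕ
    σ hub      = 0
    σ (leaf i) = proj₁ leafColours i
    σ (tip m)  = proj₁ (tipColour m)
    σ (core m) = proj₁ (coreColour m)

    σ∈hubList : ∀ {ℓ} → ℓ ≢ hub → σ ℓ ∈ hubList ℓ
    σ∈hubList {hub}    ℓ≢hub = contradiction refl ℓ≢hub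
    σ∈hubList {leaf i} _     = proj₁ (proj₂ leafColours) i
    σ∈hubList {tip m}  _     = proj₁ (proj₂ (tipColour m))
    σ∈hubList {core m} _     = proj₁ (proj₂ (coreColour m))

    open Hub σ

    1≤a : 1 ≤ a
    1≤a = ≤-trans (s≤s z≤n) 3≤a

    d-sym : IsEdgeColouring G d
    d-sym = proj₁ (headColouring-isLColouring G A 1≤a)

    tip≢rung : ∀ m → σ (tip m) ≢ rungColour m
    tip≢rung m = proj₂ (proj₂ (tipColour m)) ∘ here

    core≢rung : ∀ m → σ (core m) ≢ rungColour m
    core≢rung m = proj₂ (proj₂ (coreColour m)) ∘ here

    tip≢core : ∀ m → σ (tip m) ≢ σ (core m)
    tip≢core m = proj₂ (proj₂ (coreColour m)) ∘ there ∘ here ∘ sym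

    triangle : ∀ {ℓ ℓ′} → ℓ′ ≢ hub → ℓ′ ≢ ℓ → adjacent ℓ′ ℓ ≡ true →
      σ ℓ ≢ σ ℓ′ → σ ℓ ≢ d (vertex ℓ′) (vertex ℓ) → σ ℓ′ ≢ d (vertex ℓ′) (vertex ℓ) →
      RainbowTriangle (vertex ℓ)
    triangle {ℓ} {ℓ′} ℓ′≢hub ℓ′≢ℓ adj σ≢σ′ σ≢d σ′≢d = record
      { w      = vertex ℓ′
      ; w≢z    = vertex≢z ℓ′≢hub
      ; w≢v    = ℓ′≢ℓ ∘ vertex-injective
      ; wv     = Adj-vertex adj
      ; σv≢σw  = subst₂ _≢_ (sym (σ-vertex ℓ)) (sym (σ-vertex ℓ′)) σ≢σ′
      ; σv≢dwv = subst (_≢ _) (sym (σ-vertex ℓ)) σ≢d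
      ; σw≢dwv = subst (_≢ _) (sym (σ-vertex ℓ′)) σ′≢d
      }
      where
      σ-vertex : ∀ ℓ → σ (label (vertex ℓ)) ≡ σ ℓ
      σ-vertex ℓ = cong σ (label-vertex ℓ)

    tipTriangle : ∀ m → RainbowTriangle (vertex (tip m))
    tipTriangle m = triangle (λ ()) (λ ()) (adjacent-rung m) (tip≢core m)
      (subst (σ (tip m) ≢_) (sym rung-sym) (tip≢rung m))
      (subst (σ (core m) ≢_) (sym rung-sym) (core≢rung m))
      where
      rung-sym : d (vertex (core m)) (vertex (tip m)) ≡ rungColour m
      rung-sym = d-sym _ _ (Adj-vertex {core m} {tip m} (adjacent-rung m))

    coreTriangle : ∀ m → RainbowTriangle (vertex (core m))
    coreTriangle m = triangle (λ ()) (λ ()) (adjacent-rung m) (tip≢core m ∘ sym) (core≢rung m) (tip≢rung m)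

    triangles : ∀ ℓ ℓ′ → ℓ ≢ ℓ′ → adjacent ℓ ℓ′ ≢ true → σ ℓ ≡ σ ℓ′ →
      RainbowTriangle (vertex ℓ′) ⊎ RainbowTriangle (vertex ℓ)
    triangles _        (tip m)  _    _    _    = inj₁ (tipTriangle m)
    triangles _        (core m) _    _    _    = inj₁ (coreTriangle m)
    triangles (tip m)  (leaf _) _    _    _    = inj₂ (tipTriangle m)
    triangles (core m) (leaf _) _    _    _    = inj₂ (coreTriangle m)
    triangles (leaf _) (leaf _) ℓ≢ℓ′ _    same =
      contradiction (cong leaf (proj₁ (proj₂ (proj₂ leafColours)) same)) ℓ≢ℓ′
    triangles hub      (leaf _) _    ¬adj _    = contradiction refl ¬adj
    triangles ℓ        hub      ℓ≢ℓ′ ¬adj _    = contradiction (adjacent-toHub ℓ≢ℓ′) ¬adj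

    rainbowColouring : ∃[ c ] (IsLColouring G A c × RainbowConnected G c)
    rainbowColouring =
      hubColouring ,
      hubListColouring-isLColouring 1≤a σ σ∈hubList ,
      rainbowConnected-viaHub universal d-sym λ {u} {v} u≢v ¬uv same →
        subst₂ (λ x y → RainbowTriangle y ⊎ RainbowTriangle x) (vertex-label u) (vertex-label v)
          (triangles (label u) (label v) (label≢ u≢v) ¬uv same)

  module StrongColouring (1≤a : 1 ≤ a) (A : ListAssignment G (a + q)) where
    open HubLists A

    indexedOuterColours : ∃[ f ] ((∀ i → f i ∈ hubList (outer (Inverse.to +↔⊎ i))) ×
                                  Injective _≡_ _≡_ f × (∀ i → f i ∉ []))
    indexedOuterColours = distinctRepresentatives ℕ._≟_ [] (λ i → hubList (outer (Inverse.to +↔⊎ i)))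
                            (λ _ → hubList-unique λ ()) (λ _ → hubList-size λ ())

    outerColours : List ℕ
    outerColours = tabulate (proj₁ indexedOuterColours)

    outerColour : Outer → ℕ
    outerColour = proj₁ indexedOuterColours ∘ Inverse.from +↔⊎

    outerColour∈hubList : ∀ s → outerColour s ∈ hubList (outer s)
    outerColour∈hubList s =
      subst (λ t → outerColour s ∈ hubList (outer t)) (Inverse.strictlyInverseˡ +↔⊎ s)
        (proj₁ (proj₂ indexedOuterColours) (Inverse.from +↔⊎ s))

    outerColour∈outerColours : ∀ s → outerColour s ∈ outerColours
    outerColour∈outerColours s = ∈-tabulate⁺ (Inverse.from +↔⊎ s)

    outerColour-injective : Injective _≡_ _≡_ outerColour
    outerColour-injective =
      Injection.injective (↔⇒↣ (↔-sym +↔⊎)) ∘ proj₁ (proj₂ (proj₂ indexedOuterColours))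

    coreColour : ∀ m →
      ∃[ x ] (x ∈ hubList (core m) × x ∉ without ℕ._≟_ (outerColour (inj₂ m)) outerColours)
    coreColour m = fresh ℕ._≟_ _ (hubList-unique {core m} λ ())
      (<-≤-trans (length-without ℕ._≟_ (outerColour∈outerColours (inj₂ m)))
                 (≤-trans (≤-reflexive (length-tabulate _)) (hubList-size {core m} λ ())))

    σ : Label → ℕ
    σ hub       = 0
    σ (outer s) = outerColour s
    σ (core m)  = proj₁ (coreColour m)

    σ∈hubList : ∀ {ℓ} → ℓ ≢ hub → σ ℓ ∈ hubList ℓ
    σ∈hubList {hub}     ℓ≢hub = contradiction refl ℓ≢hub
    σ∈hubList {outer s} _     = outerColour∈hubList s
    σ∈hubList {core m}  _     = proj₁ (proj₂ (coreColour m))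

    outer≢core : ∀ s m → s ≢ inj₂ m → outerColour s ≢ σ (core m)
    outer≢core s m s≢tip same = proj₂ (proj₂ (coreColour m))
      (subst (_∈ _) same
        (∈-without⁺ ℕ._≟_ (outerColour∈outerColours s) (s≢tip ∘ outerColour-injective)))

    nonadjacent⇒≢tip : ∀ s m → adjacent (outer s) (core m) ≢ true → s ≢ inj₂ m
    nonadjacent⇒≢tip s m ¬adj refl = ¬adj (adjacent-rung m)

    separated : ∀ ℓ ℓ′ → ℓ ≢ ℓ′ → adjacent ℓ ℓ′ ≢ true → σ ℓ ≢ σ ℓ′
    separated hub       ℓ′        ℓ≢ℓ′ ¬adj = contradiction (adjacent-fromHub (ℓ≢ℓ′ ∘ sym)) ¬adj
    separated ℓ         hub       ℓ≢ℓ′ ¬adj = contradiction (adjacent-toHub ℓ≢ℓ′) ¬adj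
    separated (outer s) (outer s′) ℓ≢ℓ′ _   = ℓ≢ℓ′ ∘ cong outer ∘ outerColour-injective
    separated (outer s) (core m)  _    ¬adj = outer≢core s m (nonadjacent⇒≢tip s m ¬adj)
    separated (core m)  (outer s) _    ¬adj =
      outer≢core s m (nonadjacent⇒≢tip s m (¬adj ∘ trans (adjacent-sym (core m) (outer s)))) ∘ sym
    separated (core m)  (core m′) ℓ≢ℓ′ ¬adj =
      contradiction (cong not (dec-false (m Fin.≟ m′) (ℓ≢ℓ′ ∘ cong core))) ¬adj

    strongColouring : ∃[ c ] (IsLColouring G A c × StronglyRainbowConnected G c)
    strongColouring =
      hubColouring ,
      hubListColouring-isLColouring (≤-trans 1≤a (m≤m+n a q)) σ σ∈hubList ,
      stronglyRainbowConnected-viaHub universal λ {u} {v} u≢v ¬uv →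
        separated (label u) (label v) (label≢ u≢v) ¬uv
      where open Hub σ

  rcℓ≡a : 3 ≤ a → rcℓ≡ G a
  rcℓ≡a 3≤a = RainbowColouring.rainbowColouring 3≤a , listRC⇒a≤

  srcℓ≡a+q : 1 ≤ a → srcℓ≡ G (a + q)
  srcℓ≡a+q 1≤a = StrongColouring.strongColouring 1≤a , listSRC⇒a+q≤

lemma4p6 : ∀ (a b : ℕ) → 3 ≤ a → a < b →
    Σ Graph (λ G → Connected G × rcℓ≡ G a × srcℓ≡ G b)
lemma4p6 a b 3≤a a<b =
  G ,
  listRC⇒connected G (s≤s z≤n) (proj₁ (rcℓ≡a 3≤a)) ,
  rcℓ≡a 3≤a ,
  subst (srcℓ≡ G) (m+[n∸m]≡n (<⇒≤ a<b)) (srcℓ≡a+q (≤-trans (s≤s z≤n) 3≤a))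
  where
  open Construction a (b ∸ a)
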